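{- Let $g$ be a smooth control function and $h(x)=x\cdot g(x)$. For every ordinal $\alpha<\omega^{\omega^\omega}$ in Cantor normal form there is a constant $k$ such that for all $n>0$, $M_{\alpha,g}(n)\leq h_\alpha(kn)$.
   Context: $g:\mathbb{N}\to\mathbb{N}$ is smooth if $g(x+1)\geq g(x)+1\geq x+2$ for all $x$. Ordinals are written in Cantor normal form (CNF); $\oplus,\otimes$ denote natural sum and product. For $n>0$ define $D_n(\omega^{\omega^p})=n-1$ if $p=0$ and $\omega^{\omega^{p-1}\cdot(n-1)}\cdot(n-1)$ if $p>0$; $D_n(\omega^{\omega^{p_1}+\cdots+\omega^{p_k}})=\bigoplus_{j=1}^k\bigl(D_n(\omega^{\omega^{p_j}})\otimes\bigotimes_{\ell\neq j}\omega^{\omega^{p_\ell}}\bigr)$; and $\partial_n(\sum_{i=1}^m\omega^{\beta_i})=\{D_n(\omega^{\beta_i})\oplus\bigoplus_{\ell\neq i}\omega^{\beta_\ell}:1\leq i\leq m\}$ (every element of $\partial_n\alpha$ is $<\alpha$). Define $M_{\alpha,g}(n)=\max_{\alpha'\in\partial_n\alpha}\{1+M_{\alpha',g}(g(n))\}$ (with $\max\emptyset=0$, so $M_{0,g}=0$). Fundamental sequences for limit ordinals: $(\gamma+\omega^{\beta+1})_x=\gamma+\omega^\beta\cdot(x+1)$, $(\gamma+\omega^\lambda)_x=\gamma+\omega^{\lambda_x}$. The length hierarchy for a function $h$: $h_0(x)=0$, $h_{\alpha+1}(x)=1+h_\alpha(h(x))$, $h_\lambda(x)=h_{\lambda_x}(x)$.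 -}

module Defs where

open import Data.Nat using (ℕ; zero; suc; _+_; _*_; _∸_; _≤_; _<_; _⊔_; _≤ᵇ_; _<ᵇ_; _≡ᵇ_)
open import Data.Bool using (Bool; true; false; if_then_else_; T)
open import Data.List using (List; []; _∷_; [_]; map; foldr; replicate; _++_)
open import Data.List.Relation.Binary.Pointwise using (Pointwise)
open import Data.List.Relation.Unary.All using (All)
open import Data.Maybe using (Maybe; just; nothing)
open import Data.Product using (_×_; _,_)
open import Data.Unit using (⊤)
open import Relation.Binary.PropositionalEquality using (_≡_)

-- An exponent β < ω^ω, β = ω^p₁ + ⋯ + ω^pₖ (p₁ ≥ ⋯ ≥ pₖ), is the list p₁ ∷ ⋯ ∷ pₖ.
-- An ordinal α = ω^β₁ + ⋯ + ω^βₘ (β₁ ≥ ⋯ ≥ βₘ) is the list β₁ ∷ ⋯ ∷ βₘ.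

Exp : Set
Exp = List ℕ

Ord : Set
Ord = List Exp

-- ordinal comparison β ≤ γ of exponents in CNF (lexicographic from the top term)
leqE : Exp → Exp → Bool
leqE [] _ = true
leqE (x ∷ xs) [] = false
leqE (x ∷ xs) (y ∷ ys) = if x <ᵇ y then true else (if x ≡ᵇ y then leqE xs ys else false)

Desc : {A : Set} → (A → A → Bool) → List A → Set
Desc le [] = ⊤
Desc le (x ∷ []) = ⊤
Desc le (x ∷ y ∷ xs) = T (le y x) × Desc le (y ∷ xs)

ExpCNF : Exp → Set
ExpCNF β = Desc _≤ᵇ_ β

CNF : Ord → Set
CNF α = All ExpCNF α × Desc leqE α

-- merge of two non-increasing lists (le a b means a ≤ b)
merge : {A : Set} → (A → A → Bool) → List A → List A → List A
merge le [] ys = ys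
merge le (x ∷ xs) [] = x ∷ xs
merge le (x ∷ xs) (y ∷ ys) =
  if le y x then x ∷ merge le xs (y ∷ ys) else y ∷ merge le (x ∷ xs) ys

-- natural sum of exponents (ordinals < ω^ω)
_⊕E_ : Exp → Exp → Exp
_⊕E_ = merge _≤ᵇ_

-- natural sum and natural product of ordinals
_⊕_ : Ord → Ord → Ord
_⊕_ = merge leqE

_⊗_ : Ord → Ord → Ord
α ⊗ γ = foldr _⊕_ [] (foldr (λ β acc → map (λ δ → [ β ⊕E δ ]) γ ++ acc) [] α)

⨁ : List Ord → Ord
⨁ = foldr _⊕_ []

⨂ : List Ord → Ord
⨂ = foldr _⊗_ ([ [] ] )

picks : {A : Set} → List A → List (A × List A)
picks [] = []
picks (x ∷ xs) = (x , xs) ∷ map (λ { (y , ys) → (y , x ∷ ys) }) (picks xs)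

Dbase : ℕ → ℕ → Ord
Dbase n zero = replicate (n ∸ 1) []
Dbase n (suc p) = replicate (n ∸ 1) (replicate (n ∸ 1) p)

D : ℕ → Exp → Ord
D n β = ⨁ (map (λ { (p , rest) → Dbase n p ⊗ ⨂ (map (λ q → [ [ q ] ]) rest) }) (picks β))

-- ∂_n α  (as a list; duplicates are harmless for the maximum)
∂ : ℕ → Ord → List Ord
∂ n α = map (λ { (β , rest) → D n β ⊕ ⨁ (map (λ b → [ b ]) rest) }) (picks α)

maxL : List ℕ → ℕ
maxL = foldr _⊔_ 0

-- Graph of M_{α,g}: MR g α n m  ⇔  M_{α,g}(n) = m.
-- M_{α,g}(n) = max_{α' ∈ ∂_n α} (1 + M_{α',g}(g n)),  max ∅ = 0.
data MR (g : ℕ → ℕ) : Ord → ℕ → ℕ → Set where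
  mk : ∀ {α n} (ms : List ℕ) →
       Pointwise (λ α' m → MR g α' (g n) m) (∂ n α) ms →
       MR g α n (maxL (map suc ms))

data Kind : Set where
  zeroK : Kind
  succK : Ord → Kind          -- α = α' + 1
  limK  : (ℕ → Ord) → Kind    -- α limit with fundamental sequence α_x

lastSplit : List ℕ → Maybe (List ℕ × ℕ)
lastSplit [] = nothing
lastSplit (x ∷ []) = just ([] , x)
lastSplit (x ∷ y ∷ xs) with lastSplit (y ∷ xs)
... | nothing = nothing
... | just (ys , l) = just (x ∷ ys , l)

termKind : Exp → Kind
termKind β with lastSplit β
... | nothing = succK []                                           -- ω^0 = 0 + 1
... | just (δ , zero) = limK (λ x → replicate (suc x) δ)           -- ω^(δ+1): ω^δ·(x+1)
... | just (δ , suc p) = limK (λ x → [ δ ++ replicate (suc x) p ]) -- ω^(δ+ω^(p+1)): ω^(δ+ω^p·(x+1))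

prefixK : Exp → Kind → Kind
prefixK β zeroK = zeroK
prefixK β (succK α) = succK (β ∷ α)
prefixK β (limK f) = limK (λ x → β ∷ f x)

kind : Ord → Kind
kind [] = zeroK
kind (β ∷ []) = termKind β
kind (β ∷ γ ∷ rest) = prefixK β (kind (γ ∷ rest))

-- Graph of the length hierarchy: LH h α x m ⇔ h_α(x) = m.
data LH (h : ℕ → ℕ) : Ord → ℕ → ℕ → Set where
  lz : ∀ {α x} → kind α ≡ zeroK → LH h α x 0
  ls : ∀ {α α' x m} → kind α ≡ succK α' → LH h α' (h x) m → LH h α x (suc m)
  ll : ∀ {α f x m} → kind α ≡ limK f → LH h (f x) x m → LH h α x m

Smooth : (ℕ → ℕ) → Set
Smooth g = ∀ x → (suc (g x) ≤ g (suc x)) × (x + 2 ≤ suc (g x))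

module Submission where

-- Write γ ⇝[z] β (Reach z γ β) when β arises from γ by finitely many steps, each going from a
-- successor to its predecessor or from a limit λ to some λ_c with c ≤ z; ⇝⁺ asks for at
-- least one step.  Call α K-bounded if every exponent of α has at most K terms and occurs
-- at most K times.  The proof rests on three facts:
--  (1) Bachmann property: λ_y ⇝[y] λ_c for c ≤ y.
--  (2) Descent lemma: if α is K-bounded, n ≥ 1 and n·K ≤ z, every α' ∈ ∂_n α satisfies
--      α ⇝⁺[z] α' and is (n·K)-bounded.  It rests on: a z-bounded ordinal below a term ω^β
--      can be reached from ω^β with indices ≤ z.
--  (3) Main induction, on the derivation of h_γ(y): if γ ⇝[y] β, β is K-bounded and
--      n·K ≤ y, then M_{β,g}(n) ≤ h_γ(y).  Smoothness gives g(n)·(n·K) ≤ h(y) for the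
--      members of ∂_n β, which pay for a successor step of h; limit steps use (1).
-- With k = size α, α is k-bounded; (3) for γ = β = α and y = k·n gives the theorem.

open import Defs
open import Data.Nat using (ℕ; zero; suc; _+_; _*_; _∸_; _≤_; _<_; _≤ᵇ_; _<ᵇ_; _≡ᵇ_; _≟_; z≤n; s≤s; _≤′_; ≤′-refl; ≤′-step)
open import Data.Nat.Properties
open import Data.Bool using (Bool; true; false; if_then_else_; T)
open import Data.List using (List; []; _∷_; [_]; map; foldr; replicate; _++_; length)
open import Data.List.Properties using (++-assoc; ++-identityʳ; length-++; ≡-dec; length-replicate; length-map; length-++-≤ʳ)
open import Data.List.Relation.Unary.All using (All; []; _∷_)
import Data.List.Relation.Unary.All as All
import Data.List.Relation.Unary.All.Properties as AllP
open import Data.List.Relation.Binary.Pointwise using (Pointwise; []; _∷_)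
open import Data.Maybe using (just)
open import Data.Product using (Σ; _×_; _,_; proj₁; proj₂)
open import Data.Sum using (_⊎_; inj₁; inj₂)
open import Data.Unit using (⊤; tt)
open import Data.Empty using (⊥-elim)
open import Relation.Nullary using (¬_; Dec; yes; no)
open import Relation.Binary.Definitions using (tri<; tri≈; tri>)
open import Relation.Binary.PropositionalEquality hiding ([_])

true⇒T : ∀ {b} → b ≡ true → T b
true⇒T refl = tt

false⇒¬T : ∀ {b} → b ≡ false → ¬ T b
false⇒¬T refl ()

T⇒true : ∀ {b} → T b → b ≡ true
T⇒true {true} _ = refl

¬T⇒false : ∀ {b} → ¬ T b → b ≡ false
¬T⇒false {true} n = ⊥-elim (n tt)
¬T⇒false {false} _ = refl

if-elim : ∀ {A : Set} (P : A → Set) b {x y : A} →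
          (b ≡ true → P x) → (b ≡ false → P y) → P (if b then x else y)
if-elim P true t f = t refl
if-elim P false t f = f refl

replicate-+ : ∀ {A : Set} m n (x : A) → replicate (m + n) x ≡ replicate m x ++ replicate n x
replicate-+ zero n x = refl
replicate-+ (suc m) n x = cong (x ∷_) (replicate-+ m n x)

replicate-snoc : ∀ {A : Set} j (x : A) → replicate j x ++ [ x ] ≡ x ∷ replicate j x
replicate-snoc zero x = refl
replicate-snoc (suc j) x = cong (x ∷_) (replicate-snoc j x)

++-replicate-snoc : ∀ {A : Set} (d : List A) j x → (d ++ replicate j x) ++ [ x ] ≡ d ++ replicate (suc j) x
++-replicate-snoc d j x = trans (++-assoc d _ _) (cong (d ++_) (replicate-snoc j x))

replicate-split : ∀ {A : Set} {c y} (x : A) → c ≤ y → replicate (suc y) x ≡ replicate (suc c) x ++ replicate (y ∸ c) x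
replicate-split {c = c} {y} x c≤y =
  trans (cong (λ k → replicate (suc k) x) (sym (m+[n∸m]≡n c≤y))) (replicate-+ (suc c) (y ∸ c) x)

length-replicate-++ : ∀ {A : Set} k (x : A) Y → k ≤ length (replicate k x ++ Y)
length-replicate-++ zero x Y = z≤n
length-replicate-++ (suc k) x Y = s≤s (length-replicate-++ k x Y)

-- Dropping a non-empty run strictly shortens a list (the measure of the run recursions below).
length-run-suffix : ∀ {A : Set} k (x : A) Y → length Y < length (replicate (suc k) x ++ Y)
length-run-suffix zero x Y = ≤-refl
length-run-suffix (suc k) x Y = m≤n⇒m≤1+n (length-run-suffix k x Y)

snocView : ∀ {A : Set} (l : List A) → (l ≡ []) ⊎ Σ (List A) λ R → Σ A λ e → l ≡ R ++ [ e ]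
snocView [] = inj₁ refl
snocView (x ∷ l) with snocView l
... | inj₁ refl = inj₂ ([] , x , refl)
... | inj₂ (R , e , refl) = inj₂ (x ∷ R , e , refl)

module SortedLists {A : Set} (le : A → A → Bool)
  (le-refl : ∀ x → T (le x x))
  (le-trans : ∀ x y z → T (le x y) → T (le y z) → T (le x z))
  (le-total : ∀ x y → ¬ T (le x y) → T (le y x))
  (le-anti : ∀ x y → T (le x y) → T (le y x) → x ≡ y)
  (_≟A_ : (x y : A) → Dec (x ≡ y)) where

  -- every element dominates all later ones (the transitive form of Defs.Desc)
  Sorted : List A → Set
  Sorted [] = ⊤
  Sorted (x ∷ xs) = All (λ y → T (le y x)) xs × Sorted xs

  Desc⇒Sorted : ∀ l → Desc le l → Sorted l
  Desc⇒Sorted [] _ = tt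
  Desc⇒Sorted (x ∷ []) _ = [] , tt
  Desc⇒Sorted (x ∷ y ∷ l) (yx , d) with Desc⇒Sorted (y ∷ l) d
  ... | (ay , s) = (yx ∷ below-trans l yx ay) , (ay , s)
    where
    below-trans : ∀ zs → T (le y x) → All (λ z → T (le z y)) zs → All (λ z → T (le z x)) zs
    below-trans zs yx a = All.map (λ {z} zy → le-trans z y x zy yx) a

  merge-All : ∀ {P : A → Set} xs ys → All P xs → All P ys → All P (merge le xs ys)
  merge-All [] ys px py = py
  merge-All (x ∷ xs) [] px py = px
  merge-All {P} (x ∷ xs) (y ∷ ys) (px ∷ pxs) (py ∷ pys) =
    if-elim (All P) (le y x) (λ _ → px ∷ merge-All xs (y ∷ ys) pxs (py ∷ pys))
                             (λ _ → py ∷ merge-All (x ∷ xs) ys (px ∷ pxs) pys)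

  merge-Sorted : ∀ xs ys → Sorted xs → Sorted ys → Sorted (merge le xs ys)
  merge-Sorted [] ys sx sy = sy
  merge-Sorted (x ∷ xs) [] sx sy = sx
  merge-Sorted (x ∷ xs) (y ∷ ys) (ax , sx) (ay , sy) =
    if-elim Sorted (le y x)
      (λ y≤x → merge-All xs (y ∷ ys) ax (true⇒T y≤x ∷ lower ys (true⇒T y≤x) ay)
               , merge-Sorted xs (y ∷ ys) sx (ay , sy))
      (λ y≰x → merge-All (x ∷ xs) ys (x≤y y≰x ∷ lower xs (x≤y y≰x) ax) ay
               , merge-Sorted (x ∷ xs) ys (ax , sx) sy)
    where
    x≤y : le y x ≡ false → T (le x y)
    x≤y y≰x = le-total y x (false⇒¬T y≰x)
    lower : ∀ {u v} zs → T (le v u) → All (λ z → T (le z v)) zs → All (λ z → T (le z u)) zs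
    lower {u} {v} zs vu = All.map (λ {z} zv → le-trans z v u zv vu)

  length-merge : ∀ xs ys → length (merge le xs ys) ≡ length xs + length ys
  length-merge [] ys = refl
  length-merge (x ∷ xs) [] = sym (+-identityʳ _)
  length-merge (x ∷ xs) (y ∷ ys) =
    if-elim (λ l → length l ≡ suc (length xs + suc (length ys))) (le y x)
      (λ _ → cong suc (length-merge xs (y ∷ ys)))
      (λ _ → cong suc (trans (length-merge (x ∷ xs) ys) (sym (+-suc (length xs) (length ys)))))

  occ : A → A → ℕ
  occ e x with e ≟A x
  ... | yes _ = 1
  ... | no _ = 0

  count : A → List A → ℕ
  count e [] = 0
  count e (x ∷ xs) = occ e x + count e xs

  occ-self : ∀ x → occ x x ≡ 1
  occ-self x with x ≟A x
  ... | yes _ = refl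
  ... | no x≢x = ⊥-elim (x≢x refl)

  occ≤1 : ∀ e x → occ e x ≤ 1
  occ≤1 e x with e ≟A x
  ... | yes _ = ≤-refl
  ... | no _ = z≤n

  count≤length : ∀ e xs → count e xs ≤ length xs
  count≤length e [] = z≤n
  count≤length e (x ∷ xs) = +-mono-≤ (occ≤1 e x) (count≤length e xs)

  count-++ : ∀ e xs ys → count e (xs ++ ys) ≡ count e xs + count e ys
  count-++ e [] ys = refl
  count-++ e (x ∷ xs) ys = trans (cong (occ e x +_) (count-++ e xs ys)) (sym (+-assoc (occ e x) _ _))

  count-merge : ∀ e xs ys → count e (merge le xs ys) ≡ count e xs + count e ys
  count-merge e [] ys = refl
  count-merge e (x ∷ xs) [] = sym (+-identityʳ _)
  count-merge e (x ∷ xs) (y ∷ ys) =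
    if-elim (λ l → count e l ≡ count e (x ∷ xs) + count e (y ∷ ys)) (le y x)
      (λ _ → trans (cong (occ e x +_) (count-merge e xs (y ∷ ys))) (sym (+-assoc (occ e x) _ _)))
      (λ _ → trans (cong (occ e y +_) (count-merge e (x ∷ xs) ys)) (+-left-swap (occ e y) (occ e x + count e xs) (count e ys)))
    where
    +-left-swap : ∀ a b c → a + (b + c) ≡ b + (a + c)
    +-left-swap a b c = trans (sym (+-assoc a b c)) (trans (cong (_+ c) (+-comm a b)) (+-assoc b a c))

  count-replicate : ∀ e k x → count e (replicate k x) ≤ k
  count-replicate e zero x = z≤n
  count-replicate e (suc k) x = +-mono-≤ (occ≤1 e x) (count-replicate e k x)

  count-replicate-self : ∀ k x → count x (replicate k x) ≡ k
  count-replicate-self zero x = refl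
  count-replicate-self (suc k) x = cong₂ _+_ (occ-self x) (count-replicate-self k x)

  count-run : ∀ c x Y → suc c ≤ count x (replicate (suc c) x ++ Y)
  count-run c x Y rewrite count-++ x (replicate (suc c) x) Y | count-replicate-self (suc c) x = m≤m+n (suc c) (count x Y)

  count-suffix : ∀ e P X → count e X ≤ count e (P ++ X)
  count-suffix e P X rewrite count-++ e P X = m≤n+m (count e X) (count e P)

  count-drop : ∀ e P b C → count e (P ++ C) ≤ count e (P ++ b ∷ C)
  count-drop e P b C rewrite count-++ e P C | count-++ e P (b ∷ C) =
    +-monoʳ-≤ (count e P) (m≤n+m (count e C) (occ e b))

  merge-pass : ∀ a D X → All (λ d → ¬ T (le a d)) D → merge le D (a ∷ X) ≡ a ∷ merge le D X
  merge-pass a [] X _ = refl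
  merge-pass a (d ∷ D) X (a≰d ∷ _) with le a d
  ... | true = ⊥-elim (a≰d tt)
  ... | false = refl

  merge-passes : ∀ P D X → All (λ a → All (λ d → ¬ T (le a d)) D) P → merge le D (P ++ X) ≡ P ++ merge le D X
  merge-passes [] D X _ = refl
  merge-passes (a ∷ P) D X (pa ∷ ps) = trans (merge-pass a D (P ++ X) pa) (cong (a ∷_) (merge-passes P D X ps))

  merge-nil : ∀ D → merge le D [] ≡ D
  merge-nil [] = refl
  merge-nil (x ∷ D) = refl

  merge-single : ∀ b r → All (λ y → T (le y b)) r → merge le [ b ] r ≡ b ∷ r
  merge-single b [] _ = refl
  merge-single b (y ∷ ys) (yb ∷ _) rewrite T⇒true yb = refl

  merge-singletons : ∀ r → Sorted r → foldr (merge le) [] (map [_] r) ≡ r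
  merge-singletons [] _ = refl
  merge-singletons (b ∷ r) (ab , s) rewrite merge-singletons r s = merge-single b r ab

  replicate-below : ∀ k e → All (λ y → T (le y e)) (replicate k e)
  replicate-below k e = AllP.replicate⁺ k (le-refl e)

  replicate-Sorted : ∀ k e → Sorted (replicate k e)
  replicate-Sorted zero e = tt
  replicate-Sorted (suc k) e = replicate-below k e , replicate-Sorted k e

  merge-replicate : ∀ k e → foldr (merge le) [] (replicate k [ e ]) ≡ replicate k e
  merge-replicate zero e = refl
  merge-replicate (suc k) e rewrite merge-replicate k e = merge-single e (replicate k e) (replicate-below k e)

  All-drop : ∀ {Q : A → Set} P b C → All Q (P ++ b ∷ C) → All Q (P ++ C)
  All-drop [] b C (_ ∷ a) = a
  All-drop (x ∷ P) b C (q ∷ a) = q ∷ All-drop P b C a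

  All-middle : ∀ {Q : A → Set} P b C → All Q (P ++ b ∷ C) → Q b
  All-middle P b C a = All.head (AllP.++⁻ʳ P a)

  Sorted-drop : ∀ P b C → Sorted (P ++ b ∷ C) → Sorted (P ++ C)
  Sorted-drop [] b C (_ , s) = s
  Sorted-drop (x ∷ P) b C (a , s) = All-drop P b C a , Sorted-drop P b C s

  Sorted-suffix : ∀ P X → Sorted (P ++ X) → Sorted X
  Sorted-suffix [] X s = s
  Sorted-suffix (x ∷ P) X (_ , s) = Sorted-suffix P X s

  Sorted-prefix-above : ∀ P b C → Sorted (P ++ b ∷ C) → All (λ a → T (le b a)) P
  Sorted-prefix-above [] b C _ = []
  Sorted-prefix-above (x ∷ P) b C (a , s) = All-middle P b C a ∷ Sorted-prefix-above P b C s

  split-run : ∀ x l → Sorted (x ∷ l) → Σ ℕ λ c → Σ (List A) λ Y →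
              (x ∷ l ≡ replicate (suc c) x ++ Y) × All (λ y → ¬ T (le x y)) Y × Sorted Y
  split-run x [] _ = 0 , [] , refl , [] , tt
  split-run x (y ∷ l) ((yx ∷ ax) , sy) with y ≟A x
  ... | yes refl with split-run y l sy
  ...   | c , Y , e , aY , sY = suc c , Y , cong (y ∷_) e , aY , sY
  split-run x (y ∷ l) ((yx ∷ ax) , sy) | no y≢x =
    0 , y ∷ l , refl , (x≰y ∷ All.map (λ {z} zy xz → x≰y (le-trans x z y xz zy)) (proj₁ sy)) , sy
    where
    x≰y : ¬ T (le x y)
    x≰y xy = y≢x (sym (le-anti x y xy yx))

<ᵇ-irrefl : ∀ x → (x <ᵇ x) ≡ false
<ᵇ-irrefl zero = refl
<ᵇ-irrefl (suc x) = <ᵇ-irrefl x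

≡ᵇ-refl : ∀ x → (x ≡ᵇ x) ≡ true
≡ᵇ-refl zero = refl
≡ᵇ-refl (suc x) = ≡ᵇ-refl x

leqE-≡ : ∀ a xs ys → leqE (a ∷ xs) (a ∷ ys) ≡ leqE xs ys
leqE-≡ a xs ys rewrite <ᵇ-irrefl a | ≡ᵇ-refl a = refl

leqE-< : ∀ {a b} xs ys → a < b → leqE (a ∷ xs) (b ∷ ys) ≡ true
leqE-< xs ys a<b rewrite T⇒true (<⇒<ᵇ a<b) = refl

leqE-> : ∀ {a b} xs ys → b < a → leqE (a ∷ xs) (b ∷ ys) ≡ false
leqE-> {a} {b} xs ys b<a
  rewrite ¬T⇒false {a <ᵇ b} (λ t → <-asym (<ᵇ⇒< a b t) b<a)
        | ¬T⇒false {a ≡ᵇ b} (λ t → <-irrefl (sym (≡ᵇ⇒≡ a b t)) b<a) = refl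

leqE-prefix : ∀ P u v → leqE (P ++ u) (P ++ v) ≡ leqE u v
leqE-prefix [] u v = refl
leqE-prefix (a ∷ P) u v = trans (leqE-≡ a (P ++ u) (P ++ v)) (leqE-prefix P u v)

leqE-refl : ∀ x → T (leqE x x)
leqE-refl [] = tt
leqE-refl (a ∷ xs) rewrite leqE-≡ a xs xs = leqE-refl xs

leqE-trans : ∀ x y z → T (leqE x y) → T (leqE y z) → T (leqE x z)
leqE-trans [] y z _ _ = tt
leqE-trans (a ∷ xs) [] z () _
leqE-trans (a ∷ xs) (b ∷ ys) [] _ ()
leqE-trans (a ∷ xs) (b ∷ ys) (c ∷ zs) p q with <-cmp a b | <-cmp b c
... | _ | tri> _ _ c<b = ⊥-elim (false⇒¬T (leqE-> ys zs c<b) q)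
... | tri> _ _ b<a | _ = ⊥-elim (false⇒¬T (leqE-> xs ys b<a) p)
... | tri< a<b _ _ | tri< b<c _ _ = true⇒T (leqE-< xs zs (<-trans a<b b<c))
... | tri< a<b _ _ | tri≈ _ refl _ = true⇒T (leqE-< xs zs a<b)
... | tri≈ _ refl _ | tri< b<c _ _ = true⇒T (leqE-< xs zs b<c)
... | tri≈ _ refl _ | tri≈ _ refl _ =
  subst T (sym (leqE-≡ a xs zs)) (leqE-trans xs ys zs (subst T (leqE-≡ a xs ys) p) (subst T (leqE-≡ a ys zs) q))

leqE-total : ∀ x y → ¬ T (leqE x y) → T (leqE y x)
leqE-total [] y n = ⊥-elim (n tt)
leqE-total (a ∷ xs) [] n = tt
leqE-total (a ∷ xs) (b ∷ ys) n with <-cmp a b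
... | tri< a<b _ _ = ⊥-elim (n (true⇒T (leqE-< xs ys a<b)))
... | tri≈ _ refl _ = subst T (sym (leqE-≡ a ys xs)) (leqE-total xs ys (λ t → n (subst T (sym (leqE-≡ a xs ys)) t)))
... | tri> _ _ b<a = true⇒T (leqE-< ys xs b<a)

leqE-antisym : ∀ x y → T (leqE x y) → T (leqE y x) → x ≡ y
leqE-antisym [] [] _ _ = refl
leqE-antisym [] (b ∷ ys) _ ()
leqE-antisym (a ∷ xs) [] () _
leqE-antisym (a ∷ xs) (b ∷ ys) p q with <-cmp a b
... | tri< a<b _ _ = ⊥-elim (false⇒¬T (leqE-> ys xs a<b) q)
... | tri≈ _ refl _ = cong (a ∷_) (leqE-antisym xs ys (subst T (leqE-≡ a xs ys) p) (subst T (leqE-≡ a ys xs) q))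
... | tri> _ _ b<a = ⊥-elim (false⇒¬T (leqE-> xs ys b<a) p)

≤ᵇ-refl : ∀ x → T (x ≤ᵇ x)
≤ᵇ-refl x = ≤⇒≤ᵇ (≤-refl {x})

≤ᵇ-trans : ∀ x y z → T (x ≤ᵇ y) → T (y ≤ᵇ z) → T (x ≤ᵇ z)
≤ᵇ-trans x y z p q = ≤⇒≤ᵇ (≤-trans (≤ᵇ⇒≤ x y p) (≤ᵇ⇒≤ y z q))

≤ᵇ-total : ∀ x y → ¬ T (x ≤ᵇ y) → T (y ≤ᵇ x)
≤ᵇ-total x y n = ≤⇒≤ᵇ {y} {x} (<⇒≤ (≰⇒> {x} {y} (λ xy → n (≤⇒≤ᵇ xy))))

≤ᵇ-antisym : ∀ x y → T (x ≤ᵇ y) → T (y ≤ᵇ x) → x ≡ y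
≤ᵇ-antisym x y p q = ≤-antisym (≤ᵇ⇒≤ x y p) (≤ᵇ⇒≤ y x q)

module OnExp = SortedLists _≤ᵇ_ ≤ᵇ-refl ≤ᵇ-trans ≤ᵇ-total ≤ᵇ-antisym _≟_
module OnOrd = SortedLists leqE leqE-refl leqE-trans leqE-total leqE-antisym (≡-dec _≟_)

-- Fundamental sequences in the snoc view.  Writing α = R + ω^e, the kind of α is decided
-- by its last term alone and the remaining terms R are carried along unchanged.

liftK : Ord → Kind → Kind
liftK R zeroK = zeroK
liftK R (succK a) = succK (R ++ a)
liftK R (limK f) = limK (λ x → R ++ f x)

liftK-[] : ∀ k → liftK [] k ≡ k
liftK-[] zeroK = refl
liftK-[] (succK a) = refl
liftK-[] (limK f) = refl

prefixK-liftK : ∀ r R k → prefixK r (liftK R k) ≡ liftK (r ∷ R) k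
prefixK-liftK r R zeroK = refl
prefixK-liftK r R (succK a) = refl
prefixK-liftK r R (limK f) = refl

kind-snoc : ∀ R e → kind (R ++ [ e ]) ≡ liftK R (termKind e)
kind-snoc [] e = sym (liftK-[] (termKind e))
kind-snoc (r ∷ []) e = trans (cong (prefixK r) (sym (liftK-[] _))) (prefixK-liftK r [] (termKind e))
kind-snoc (r ∷ r₂ ∷ R) e = trans (cong (prefixK r) (kind-snoc (r₂ ∷ R) e)) (prefixK-liftK r (r₂ ∷ R) (termKind e))

lastSplit-snoc : ∀ d p → lastSplit (d ++ [ p ]) ≡ just (d , p)
lastSplit-snoc [] p = refl
lastSplit-snoc (x ∷ []) p = refl
lastSplit-snoc (x ∷ y ∷ d) p rewrite lastSplit-snoc (y ∷ d) p = refl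

kind-succ : ∀ R → kind (R ++ [ [] ]) ≡ succK R
kind-succ R = trans (kind-snoc R []) (cong succK (++-identityʳ R))

kind-lim-zero : ∀ R d → kind (R ++ [ d ++ [ 0 ] ]) ≡ limK (λ x → R ++ replicate (suc x) d)
kind-lim-zero R d = trans (kind-snoc R _) (cong (liftK R) (termKind-zero d))
  where
  termKind-zero : ∀ d → termKind (d ++ [ 0 ]) ≡ limK (λ x → replicate (suc x) d)
  termKind-zero d rewrite lastSplit-snoc d 0 = refl

kind-lim-suc : ∀ R d q → kind (R ++ [ d ++ [ suc q ] ]) ≡ limK (λ x → R ++ [ d ++ replicate (suc x) q ])
kind-lim-suc R d q = trans (kind-snoc R _) (cong (liftK R) (termKind-suc d q))
  where
  termKind-suc : ∀ d q → termKind (d ++ [ suc q ]) ≡ limK (λ x → [ d ++ replicate (suc x) q ])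
  termKind-suc d q rewrite lastSplit-snoc d (suc q) = refl

limK-injective : ∀ {f f'} → limK f ≡ limK f' → f ≡ f'
limK-injective refl = refl

succK-injective : ∀ {a b} → succK a ≡ succK b → a ≡ b
succK-injective refl = refl

zeroK≢succK : ∀ {a} → zeroK ≢ succK a
zeroK≢succK ()

zeroK≢limK : ∀ {f} → zeroK ≢ limK f
zeroK≢limK ()

succK≢limK : ∀ {a f} → succK a ≢ limK f
succK≢limK ()

module ExpInduction (P : Exp → Set) (p[] : P [])
    (p-zero : ∀ d → P d → P (d ++ [ 0 ]))
    (p-suc : ∀ d q → (∀ j → P (d ++ replicate j q)) → P (d ++ [ suc q ])) where

  append-run : ∀ d → P d → ∀ q j → P (d ++ replicate j q)
  append-run d pd q zero = subst P (sym (++-identityʳ d)) pd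
  append-run d pd zero (suc j) = subst P (++-replicate-snoc d j 0) (p-zero _ (append-run d pd zero j))
  append-run d pd (suc q) (suc j) =
    subst P (++-replicate-snoc d j (suc q))
      (p-suc _ q (append-run (d ++ replicate j (suc q)) (append-run d pd (suc q) j) q))

  append : ∀ e d → P d → P (d ++ e)
  append [] d pd = subst P (sym (++-identityʳ d)) pd
  append (p ∷ e) d pd = subst P (++-assoc d [ p ] e) (append e (d ++ [ p ]) (append-run d pd p 1))

  exp-ind : ∀ e → P e
  exp-ind e = append e [] p[]

-- Reach⁺ demands
-- at least one step, so it relates γ only to ordinals strictly below it.
data Reach (z : ℕ) : Ord → Ord → Set where
  rrefl : ∀ {γ} → Reach z γ γ
  rsucc : ∀ {γ γ' β} → kind γ ≡ succK γ' → Reach z γ' β → Reach z γ β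
  rlim : ∀ {γ f c β} → kind γ ≡ limK f → c ≤ z → Reach z (f c) β → Reach z γ β

data Reach⁺ (z : ℕ) : Ord → Ord → Set where
  psucc : ∀ {γ γ' β} → kind γ ≡ succK γ' → Reach z γ' β → Reach⁺ z γ β
  plim : ∀ {γ f c β} → kind γ ≡ limK f → c ≤ z → Reach⁺ z (f c) β → Reach⁺ z γ β

Reach-trans : ∀ {z a b c} → Reach z a b → Reach z b c → Reach z a c
Reach-trans rrefl q = q
Reach-trans (rsucc e p) q = rsucc e (Reach-trans p q)
Reach-trans (rlim e l p) q = rlim e l (Reach-trans p q)

Reach⁺⇒Reach : ∀ {z a b} → Reach⁺ z a b → Reach z a b
Reach⁺⇒Reach (psucc e p) = rsucc e p
Reach⁺⇒Reach (plim e l p) = rlim e l (Reach⁺⇒Reach p)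

Reach-Reach⁺-trans : ∀ {z a b c} → Reach z a b → Reach⁺ z b c → Reach⁺ z a c
Reach-Reach⁺-trans rrefl q = q
Reach-Reach⁺-trans (rsucc e p) q = psucc e (Reach-trans p (Reach⁺⇒Reach q))
Reach-Reach⁺-trans (rlim e l p) q = plim e l (Reach-Reach⁺-trans p q)

Reach-mono : ∀ {z z' a b} → z ≤ z' → Reach z a b → Reach z' a b
Reach-mono le rrefl = rrefl
Reach-mono le (rsucc e p) = rsucc e (Reach-mono le p)
Reach-mono le (rlim e l p) = rlim e (≤-trans l le) (Reach-mono le p)

-- R + ω^e ⇝⁺ R: repeatedly take the 0-th element of fundamental sequences
drop-last-term : ∀ z e R → Reach⁺ z (R ++ [ e ]) R
drop-last-term z = ExpInduction.exp-ind (λ e → ∀ R → Reach⁺ z (R ++ [ e ]) R)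
  (λ R → psucc (kind-succ R) rrefl)
  (λ d pd R → plim (kind-lim-zero R d) z≤n (pd R))
  (λ d q ih R → plim (kind-lim-suc R d q) z≤n (ih 1 R))

drop-terms : ∀ z X R → Reach z (R ++ X) R
drop-terms z [] R = subst (λ l → Reach z l R) (sym (++-identityʳ R)) rrefl
drop-terms z (x ∷ X) R = subst (λ l → Reach z l R) (++-assoc R [ x ] X)
  (Reach-trans (drop-terms z X (R ++ [ x ])) (Reach⁺⇒Reach (drop-last-term z x R)))

drop-exp-term : ∀ z x R d → Reach z (R ++ [ d ++ [ x ] ]) (R ++ [ d ])
drop-exp-term z zero R d = rlim (kind-lim-zero R d) z≤n rrefl
drop-exp-term z (suc q) R d = rlim (kind-lim-suc R d q) z≤n (drop-exp-term z q R d)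

drop-exp-terms : ∀ z X R d → Reach z (R ++ [ d ++ X ]) (R ++ [ d ])
drop-exp-terms z [] R d = subst (λ l → Reach z (R ++ [ l ]) (R ++ [ d ])) (sym (++-identityʳ d)) rrefl
drop-exp-terms z (x ∷ X) R d = subst (λ l → Reach z (R ++ [ l ]) (R ++ [ d ])) (++-assoc d [ x ] X)
  (Reach-trans (drop-exp-terms z X R (d ++ [ x ])) (drop-exp-term z x R d))

lower-exp-term : ∀ z j q R d → Reach z (R ++ [ d ++ [ j + q ] ]) (R ++ [ d ++ [ q ] ])
lower-exp-term z zero q R d = rrefl
lower-exp-term z (suc j) q R d = rlim (kind-lim-suc R d (j + q)) z≤n (lower-exp-term z j q R d)

-- Bachmann property: λ_y ⇝[y] λ_c for c ≤ y, since λ_y is λ_c followed by further terms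
-- (of the ordinal or of its last exponent).
bachmann : ∀ γ f {y c} → kind γ ≡ limK f → c ≤ y → Reach y (f y) (f c)
bachmann γ f {y} {c} eq c≤y with snocView γ
... | inj₁ refl = ⊥-elim (zeroK≢limK eq)
... | inj₂ (R , e , refl) with snocView e
...   | inj₁ refl = ⊥-elim (succK≢limK (trans (sym (kind-succ R)) eq))
...   | inj₂ (d , zero , refl) with limK-injective (trans (sym eq) (kind-lim-zero R d))
...     | refl = subst (λ l → Reach y (R ++ l) (R ++ replicate (suc c) d)) (sym (replicate-split d c≤y))
                   (subst (λ l → Reach y l (R ++ replicate (suc c) d)) (++-assoc R (replicate (suc c) d) _)
                     (drop-terms y (replicate (y ∸ c) d) (R ++ replicate (suc c) d)))
bachmann γ f {y} {c} eq c≤y | inj₂ (R , e , refl) | inj₂ (d , suc q , refl)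
  with limK-injective (trans (sym eq) (kind-lim-suc R d q))
... | refl = subst (λ l → Reach y (R ++ [ d ++ l ]) (R ++ [ d ++ replicate (suc c) q ])) (sym (replicate-split q c≤y))
               (subst (λ l → Reach y (R ++ [ l ]) (R ++ [ d ++ replicate (suc c) q ])) (++-assoc d (replicate (suc c) q) _)
                 (drop-exp-terms y (replicate (y ∸ c) q) R (d ++ replicate (suc c) q)))

Normal : Ord → Set
Normal α = OnOrd.Sorted α × All OnExp.Sorted α

-- Bounds on these two quantities are exactly what limits the fundamental-sequence
-- indices needed to reach an ordinal (descend-below-term).
Bounded : ℕ → Ord → Set
Bounded K α = (∀ e → OnOrd.count e α ≤ K) × All (λ e → length e ≤ K) α

Normal-suffix : ∀ P X → Normal (P ++ X) → Normal X
Normal-suffix P X (s , a) = OnOrd.Sorted-suffix P X s , AllP.++⁻ʳ P a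

Bounded-suffix : ∀ {z} P X → Bounded z (P ++ X) → Bounded z X
Bounded-suffix P X (c , l) = (λ e → ≤-trans (OnOrd.count-suffix e P X) (c e)) , AllP.++⁻ʳ P l

-- Let x₁^(c+1) be the leading run of x: lower ω^q to ω^(x₁+1), pass to the
-- element with index c+1 of the fundamental sequence, R + ω^(d+ω^x₁·(c+2)), and recurse on
-- its last copy of ω^x₁ with the rest of x.
-- The recursion is on a bound `fuel` for the length of x.
descend-exp-term : ∀ z fuel x q R d → length x ≤ fuel → OnExp.Sorted x → All (λ y → ¬ T (q ≤ᵇ y)) x →
    length x ≤ z → Reach z (R ++ [ d ++ [ q ] ]) (R ++ [ d ++ (x ++ [ 0 ]) ])
descend-exp-term z fuel [] q R d _ _ _ _ =
  subst (λ k → Reach z (R ++ [ d ++ [ k ] ]) (R ++ [ d ++ [ 0 ] ])) (+-identityʳ q) (lower-exp-term z q 0 R d)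
descend-exp-term z (suc fuel) (x₁ ∷ x') q R d |x|≤fuel sx (q≰x₁ ∷ _) |x|≤z with OnExp.split-run x₁ x' sx
... | c , Y , x≡run , Y<x₁ , sY =
  Reach-trans lower (Reach-trans expand (subst (Reach z _) (cong (λ l → R ++ [ l ]) rest≡x) recurse))
  where
  d' = d ++ replicate (suc c) x₁
  |run|≤z : length (replicate (suc c) x₁ ++ Y) ≤ z
  |run|≤z = subst (λ l → length l ≤ z) x≡run |x|≤z
  |Y|≤fuel : length Y ≤ fuel
  |Y|≤fuel = ≤-pred (≤-trans (length-run-suffix c x₁ Y) (subst (λ l → length l ≤ suc fuel) x≡run |x|≤fuel))
  lower : Reach z (R ++ [ d ++ [ q ] ]) (R ++ [ d ++ [ suc x₁ ] ])
  lower = subst (λ k → Reach z (R ++ [ d ++ [ k ] ]) (R ++ [ d ++ [ suc x₁ ] ]))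
            (m∸n+n≡m (≰⇒> (λ qx → q≰x₁ (≤⇒≤ᵇ qx)))) (lower-exp-term z (q ∸ suc x₁) (suc x₁) R d)
  expand : Reach z (R ++ [ d ++ [ suc x₁ ] ]) (R ++ [ d' ++ [ x₁ ] ])
  expand = rlim (kind-lim-suc R d x₁) (≤-trans (length-replicate-++ (suc c) x₁ Y) |run|≤z)
             (subst (λ l → Reach z (R ++ [ l ]) (R ++ [ d' ++ [ x₁ ] ])) (++-replicate-snoc d (suc c) x₁) rrefl)
  recurse : Reach z (R ++ [ d' ++ [ x₁ ] ]) (R ++ [ d' ++ (Y ++ [ 0 ]) ])
  recurse = descend-exp-term z fuel Y x₁ R d' |Y|≤fuel sY Y<x₁ (≤-trans (<⇒≤ (length-run-suffix c x₁ Y)) |run|≤z)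
  rest≡x : d' ++ (Y ++ [ 0 ]) ≡ d ++ ((x₁ ∷ x') ++ [ 0 ])
  rest≡x = trans (++-assoc d _ _)
             (cong (d ++_) (trans (sym (++-assoc (replicate (suc c) x₁) Y [ 0 ])) (cong (_++ [ 0 ]) (sym x≡run))))

exp-<-split : ∀ β x → OnExp.Sorted x → ¬ T (leqE β x) →
  Σ (List ℕ) λ A → Σ ℕ λ b → Σ (List ℕ) λ B → Σ (List ℕ) λ x' →
    (β ≡ A ++ b ∷ B) × (x ≡ A ++ x') × All (λ y → ¬ T (b ≤ᵇ y)) x'
exp-<-split [] x s β≰x = ⊥-elim (β≰x tt)
exp-<-split (b ∷ B) [] s β≰x = [] , b , B , [] , refl , refl , []
exp-<-split (b ∷ B) (a ∷ x'') (ax , s) β≰x with <-cmp b a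
... | tri< b<a _ _ = ⊥-elim (β≰x (true⇒T (leqE-< B x'' b<a)))
... | tri≈ _ refl _ with exp-<-split B x'' s (λ t → β≰x (subst T (sym (leqE-≡ b B x'')) t))
...   | A , b' , B' , x' , e₁ , e₂ , x'<b' = b ∷ A , b' , B' , x' , cong (b ∷_) e₁ , cong (b ∷_) e₂ , x'<b'
exp-<-split (b ∷ B) (a ∷ x'') (ax , s) β≰x | tri> _ _ a<b =
  [] , b , B , a ∷ x'' , refl , refl , (b≰ a<b ∷ All.map (λ {y} ya → b≰ (≤-<-trans (≤ᵇ⇒≤ y a ya) a<b)) ax)
  where
  b≰ : ∀ {y} → y < b → ¬ T (b ≤ᵇ y)
  b≰ y<b t = <-irrefl refl (≤-<-trans (≤ᵇ⇒≤ b _ t) y<b)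

descend-to-exp-succ : ∀ z β x → OnExp.Sorted x → ¬ T (leqE β x) → length x ≤ z → ∀ P →
    Reach z (P ++ [ β ]) (P ++ [ x ++ [ 0 ] ])
descend-to-exp-succ z β x s x<β |x|≤z P with exp-<-split β x s x<β
... | A , b , B , x' , refl , refl , x'<b =
  Reach-trans (subst (λ l → Reach z (P ++ [ l ]) (P ++ [ A ++ [ b ] ])) (++-assoc A [ b ] B) (drop-exp-terms z B P (A ++ [ b ])))
    (subst (λ l → Reach z (P ++ [ A ++ [ b ] ]) (P ++ [ l ])) (sym (++-assoc A x' [ 0 ]))
      (descend-exp-term z (length x') x' b P A ≤-refl (OnExp.Sorted-suffix A x' s) x'<b
        (≤-trans (length-++-≤ʳ x' {A}) |x|≤z)))

-- With
-- x₁^(c+1) the leading run of X: descend ω^β to ω^(x₁+1), pass to the element with index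
-- c+1 of the fundamental sequence, P + ω^x₁·(c+2), and recurse on its last copy of ω^x₁ with
-- the rest of X.
descend-below-term : ∀ z fuel X β P → length X ≤ fuel → Normal X → All (λ e → ¬ T (leqE β e)) X →
    Bounded z X → Reach⁺ z (P ++ [ β ]) (P ++ X)
descend-below-term z fuel [] β P _ _ _ _ = subst (Reach⁺ z (P ++ [ β ])) (sym (++-identityʳ P)) (drop-last-term z β P)
descend-below-term z (suc fuel) (x₁ ∷ X') β P |X|≤fuel nX@(sX , s₁ ∷ _) (x₁<β ∷ _) bX@(cX , l₁ ∷ _)
  with OnOrd.split-run x₁ X' sX
... | c , Y , X≡run , Y<x₁ , sY = Reach-Reach⁺-trans (Reach-trans lower expand) (subst (Reach⁺ z _) rest≡X recurse)
  where
  P' = P ++ replicate (suc c) x₁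
  lower : Reach z (P ++ [ β ]) (P ++ [ x₁ ++ [ 0 ] ])
  lower = descend-to-exp-succ z β x₁ s₁ x₁<β l₁ P
  expand : Reach z (P ++ [ x₁ ++ [ 0 ] ]) (P' ++ [ x₁ ])
  expand = rlim (kind-lim-zero P x₁)
             (≤-trans (OnOrd.count-run c x₁ Y) (subst (λ l → OnOrd.count x₁ l ≤ z) X≡run (cX x₁)))
             (subst (λ l → Reach z l (P' ++ [ x₁ ])) (++-replicate-snoc P (suc c) x₁) rrefl)
  |Y|≤fuel : length Y ≤ fuel
  |Y|≤fuel = ≤-pred (≤-trans (length-run-suffix c x₁ Y) (subst (λ l → length l ≤ suc fuel) X≡run |X|≤fuel))
  recurse : Reach⁺ z (P' ++ [ x₁ ]) (P' ++ Y)
  recurse = descend-below-term z fuel Y x₁ P' |Y|≤fuel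
              (sY , AllP.++⁻ʳ (replicate (suc c) x₁) (subst (All OnExp.Sorted) X≡run (proj₂ nX))) Y<x₁
              (Bounded-suffix (replicate (suc c) x₁) Y (subst (Bounded z) X≡run bX))
  rest≡X : P' ++ Y ≡ P ++ x₁ ∷ X'
  rest≡X = trans (++-assoc P _ Y) (cong (P ++_) (sym X≡run))

drop-and-descend : ∀ z C P b X → All (λ c → ¬ T (leqE b c)) X → Normal (P ++ X) → Bounded z (P ++ X) →
    Reach⁺ z (P ++ b ∷ C) (P ++ X)
drop-and-descend z C P b X X<b nPX bPX =
  Reach-Reach⁺-trans (subst (λ l → Reach z l (P ++ [ b ])) (++-assoc P [ b ] C) (drop-terms z C (P ++ [ b ])))
    (descend-below-term z (length X) X b P ≤-refl (Normal-suffix P X nPX) X<b (Bounded-suffix P X bPX))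

-- Copies of ω^b at the front of C stay in place; once
-- the rest of C is below b, it is dropped and ω^b descends to D ⊕ C.
replace-term : ∀ z C P b D → OnOrd.Sorted (b ∷ C) → All (λ d → ¬ T (leqE b d)) D →
    Normal (P ++ merge leqE D C) → Bounded z (P ++ merge leqE D C) → Reach⁺ z (P ++ b ∷ C) (P ++ merge leqE D C)
replace-term z [] P b D _ D<b = drop-and-descend z [] P b _ (OnOrd.merge-All D [] D<b [])
replace-term z (c ∷ C₁) P b D ((c≤b ∷ _) , (C₁≤c , sC₁)) D<b nZ bZ with ≡-dec _≟_ c b
... | no c≢b = drop-and-descend z (c ∷ C₁) P b _ (OnOrd.merge-All D (c ∷ C₁) D<b (c<b ∷ C₁<b)) nZ bZ
  where
  c<b : ¬ T (leqE b c)
  c<b b≤c = c≢b (leqE-antisym c b c≤b b≤c)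
  C₁<b : All (λ c' → ¬ T (leqE b c')) C₁
  C₁<b = All.map (λ {c'} c'≤c b≤c' → c<b (leqE-trans b c' c b≤c' c'≤c)) C₁≤c
... | yes refl = subst₂ (Reach⁺ z) (++-assoc P [ c ] (c ∷ C₁)) (sym shift)
                   (replace-term z C₁ (P ++ [ c ]) c D (C₁≤c , sC₁) D<b (subst Normal shift nZ) (subst (Bounded z) shift bZ))
  where
  shift : P ++ merge leqE D (c ∷ C₁) ≡ (P ++ [ c ]) ++ merge leqE D C₁
  shift = trans (cong (P ++_) (OnOrd.merge-pass c D C₁ D<b)) (sym (++-assoc P [ c ] _))

-- The derivative D_n(ω^b).  For b = ω^p₁ + ⋯ + ω^pₖ, the summand belonging to pᵢ is
-- ω^(dexp n pᵢ ⊕ (b without ω^pᵢ))·(n∸1), where D_n(ω^(ω^p)) = ω^(dexp n p)·(n∸1).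

dexp : ℕ → ℕ → Exp
dexp n zero = []
dexp n (suc p) = replicate (n ∸ 1) p

Dbase-≡ : ∀ n p → Dbase n p ≡ replicate (n ∸ 1) (dexp n p)
Dbase-≡ n zero = refl
Dbase-≡ n (suc p) = refl

⨂-singletons : ∀ rest → OnExp.Sorted rest → ⨂ (map (λ q → [ [ q ] ]) rest) ≡ [ rest ]
⨂-singletons [] _ = refl
⨂-singletons (q ∷ rest) (aq , s) rewrite ⨂-singletons rest s | OnExp.merge-single q rest aq = refl

replicate-⊗ : ∀ k d e → replicate k d ⊗ [ e ] ≡ replicate k (d ⊕E e)
replicate-⊗ k d e = trans (cong (foldr _⊕_ []) (products k)) (OnOrd.merge-replicate k (d ⊕E e))
  where
  products : ∀ k → foldr (λ β acc → map (λ δ → [ β ⊕E δ ]) [ e ] ++ acc) [] (replicate k d)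
                   ≡ replicate k [ d ⊕E e ]
  products zero = refl
  products (suc k) = cong ([ d ⊕E e ] ∷_) (products k)

D-summand-≡ : ∀ n p rest → OnExp.Sorted rest →
    Dbase n p ⊗ ⨂ (map (λ q → [ [ q ] ]) rest) ≡ replicate (n ∸ 1) (dexp n p ⊕E rest)
D-summand-≡ n p rest s rewrite ⨂-singletons rest s | Dbase-≡ n p = replicate-⊗ (n ∸ 1) (dexp n p) rest

dexp-below : ∀ n p → All (λ y → ¬ T (p ≤ᵇ y)) (dexp n p)
dexp-below n zero = []
dexp-below n (suc p) = AllP.replicate⁺ (n ∸ 1) (λ t → <-irrefl refl (≤ᵇ⇒≤ (suc p) p t))

dexp-Sorted : ∀ n p → OnExp.Sorted (dexp n p)
dexp-Sorted n zero = tt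
dexp-Sorted n (suc p) = OnExp.replicate-Sorted (n ∸ 1) p

length-dexp : ∀ n p → length (dexp n p) ≤ n ∸ 1
length-dexp n zero = z≤n
length-dexp n (suc p) = ≤-reflexive (length-replicate (n ∸ 1))

below-leading : ∀ p C X → All (λ y → ¬ T (p ≤ᵇ y)) X → ¬ T (leqE (p ∷ C) X)
below-leading p C [] _ ()
below-leading p C (y ∷ X) (p≰y ∷ _) = false⇒¬T (leqE-> {p} {y} C X (≰⇒> {p} {y} (λ py → p≰y (≤⇒≤ᵇ py))))

replace-exp-term : ∀ p C M → OnExp.Sorted (p ∷ C) → All (λ m → ¬ T (p ≤ᵇ m)) M → ¬ T (leqE (p ∷ C) (M ⊕E C))
replace-exp-term p [] M _ M<p rewrite OnExp.merge-nil M = below-leading p [] M M<p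
replace-exp-term p (c ∷ C₁) M ((c≤p ∷ _) , (C₁≤c , sC₁)) M<p with c ≟ p
... | yes refl = λ t → replace-exp-term p C₁ M (C₁≤c , sC₁) M<p
        (subst T (leqE-≡ p (p ∷ C₁) (M ⊕E C₁))
          (subst (λ l → T (leqE (p ∷ p ∷ C₁) l)) (OnExp.merge-pass p M C₁ M<p) t))
... | no c≢p = below-leading p (c ∷ C₁) (M ⊕E (c ∷ C₁))
                 (OnExp.merge-All M (c ∷ C₁) M<p
                   (c<p ∷ All.map (λ {c'} c'≤c p≤c' → c<p (≤ᵇ-trans p c' c p≤c' c'≤c)) C₁≤c))
  where
  c<p : ¬ T (p ≤ᵇ c)
  c<p p≤c = c≢p (≤ᵇ-antisym c p c≤p p≤c)

-- What is used of a term ω^E of D_n(ω^b): E is sorted, below b, and not much longer than b.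
DTerm : ℕ → Exp → Exp → Set
DTerm n b E = OnExp.Sorted E × ¬ T (leqE b E) × length E ≤ (n ∸ 1) + length b

DTerm-dexp : ∀ n P p C → OnExp.Sorted (P ++ p ∷ C) → DTerm n (P ++ p ∷ C) (dexp n p ⊕E (P ++ C))
DTerm-dexp n P p C s = sorted , below , short
  where
  P-passes : All (λ a → All (λ d → ¬ T (a ≤ᵇ d)) (dexp n p)) P
  P-passes = All.map (λ {a} p≤a → All.map (λ {d} p≰d a≤d → p≰d (≤ᵇ-trans p a d p≤a a≤d)) (dexp-below n p))
               (OnExp.Sorted-prefix-above P p C s)
  sorted = OnExp.merge-Sorted (dexp n p) (P ++ C) (dexp-Sorted n p) (OnExp.Sorted-drop P p C s)
  below : ¬ T (leqE (P ++ p ∷ C) (dexp n p ⊕E (P ++ C)))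
  below rewrite OnExp.merge-passes P (dexp n p) C P-passes | leqE-prefix P (p ∷ C) (dexp n p ⊕E C) =
    replace-exp-term p C (dexp n p) (OnExp.Sorted-suffix P (p ∷ C) s) (dexp-below n p)
  short : length (dexp n p ⊕E (P ++ C)) ≤ (n ∸ 1) + length (P ++ p ∷ C)
  short rewrite OnExp.length-merge (dexp n p) (P ++ C) | length-++ P {C} | length-++ P {p ∷ C} =
    +-mono-≤ (length-dexp n p) (+-monoʳ-≤ (length P) (n≤1+n (length C)))

picks-split : ∀ {A : Set} (l : List A) →
  All (λ pr → Σ (List A) λ P → Σ (List A) λ C → (l ≡ P ++ proj₁ pr ∷ C) × (proj₂ pr ≡ P ++ C)) (picks l)
picks-split [] = []
picks-split (x ∷ l) = ([] , l , refl , refl) ∷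
  AllP.map⁺ (All.map (λ { (P , C , e₁ , e₂) → x ∷ P , C , cong (x ∷_) e₁ , cong (x ∷_) e₂ }) (picks-split l))

length-picks : ∀ {A : Set} (l : List A) → length (picks l) ≡ length l
length-picks [] = refl
length-picks (x ∷ l) = cong suc (trans (length-map _ (picks l)) (length-picks l))

⨁-All : ∀ {X : Set} {Q : Exp → Set} (F : X → Ord) L → All (λ x → All Q (F x)) L → All Q (⨁ (map F L))
⨁-All F [] _ = []
⨁-All F (x ∷ L) (a ∷ as) = OnOrd.merge-All (F x) _ a (⨁-All F L as)

⨁-Sorted : ∀ {X : Set} (F : X → Ord) L → All (λ x → OnOrd.Sorted (F x)) L → OnOrd.Sorted (⨁ (map F L))
⨁-Sorted F [] _ = tt
⨁-Sorted F (x ∷ L) (a ∷ as) = OnOrd.merge-Sorted (F x) _ a (⨁-Sorted F L as)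

⨁-count : ∀ {X : Set} e k (F : X → Ord) L → All (λ x → OnOrd.count e (F x) ≤ k) L →
    OnOrd.count e (⨁ (map F L)) ≤ k * length L
⨁-count e k F [] _ = z≤n
⨁-count e k F (x ∷ L) (a ∷ as) rewrite OnOrd.count-merge e (F x) (⨁ (map F L)) | *-suc k (length L) =
  +-mono-≤ a (⨁-count e k F L as)

D-summands : ∀ n b → OnExp.Sorted b → All (λ pr → Σ Exp λ E →
   (Dbase n (proj₁ pr) ⊗ ⨂ (map (λ q → [ [ q ] ]) (proj₂ pr)) ≡ replicate (n ∸ 1) E) × DTerm n b E) (picks b)
D-summands n b s = All.map (λ { {(p , rest)} (P , C , refl , refl) →
     dexp n p ⊕E (P ++ C) , D-summand-≡ n p (P ++ C) (OnExp.Sorted-drop P p C s) , DTerm-dexp n P p C s }) (picks-split b)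

D-terms : ∀ n b → OnExp.Sorted b → All (DTerm n b) (D n b)
D-terms n b s = ⨁-All _ (picks b)
  (All.map (λ { (E , eq , tE) → subst (All (DTerm n b)) (sym eq) (AllP.replicate⁺ (n ∸ 1) tE) }) (D-summands n b s))

D-Sorted : ∀ n b → OnExp.Sorted b → OnOrd.Sorted (D n b)
D-Sorted n b s = ⨁-Sorted _ (picks b)
  (All.map (λ { (E , eq , _) → subst OnOrd.Sorted (sym eq) (OnOrd.replicate-Sorted (n ∸ 1) E) }) (D-summands n b s))

-- D_n(ω^b) has k = |b| summands, so no exponent occurs in it more than (n∸1)·k times
D-count : ∀ n b → OnExp.Sorted b → ∀ e → OnOrd.count e (D n b) ≤ (n ∸ 1) * length b
D-count n b s e = subst (λ k → OnOrd.count e (D n b) ≤ (n ∸ 1) * k) (length-picks b)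
  (⨁-count e (n ∸ 1) _ (picks b)
    (All.map (λ { (E , eq , _) → subst (λ l → OnOrd.count e l ≤ n ∸ 1) (sym eq) (OnOrd.count-replicate e (n ∸ 1) E) })
      (D-summands n b s)))

Bounded-mono : ∀ {K K' α} → K ≤ K' → Bounded K α → Bounded K' α
Bounded-mono K≤K' (c , l) = (λ e → ≤-trans (c e) K≤K') , All.map (λ le → ≤-trans le K≤K') l

Bounded-pos : ∀ {K} P b C → Bounded K (P ++ b ∷ C) → 1 ≤ K
Bounded-pos P b C (c , _) = ≤-trans (≤-trans (OnOrd.count-run 0 b C) (OnOrd.count-suffix b P (b ∷ C))) (c b)

n≤n*K : ∀ n {K} → 1 ≤ K → n ≤ n * K
n≤n*K n 1≤K = subst (_≤ n * _) (*-identityʳ n) (*-monoʳ-≤ n 1≤K)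

-- The member of ∂_n α for the term ω^b of α = P + ω^b + C is D_n(ω^b) ⊕ (P + C).  If α is
-- normal and K-bounded, this ordinal is normal and (n·K)-bounded: D_n(ω^b) adds at most
-- (n∸1)·|b| ≤ (n∸1)·K copies of an exponent, and exponents of length ≤ (n∸1) + |b|.
∂-member-normal-bounded : ∀ n' K P b C → Normal (P ++ b ∷ C) → Bounded K (P ++ b ∷ C) →
    Normal (merge leqE (D (suc n') b) (P ++ C)) × Bounded (suc n' * K) (merge leqE (D (suc n') b) (P ++ C))
∂-member-normal-bounded n' K P b C (sα , nα) bα@(cα , lα) = (sorted , normal-exps) , (counts , lengths)
  where
  n = suc n'
  sb = OnOrd.All-middle P b C nα
  |b|≤K = OnOrd.All-middle P b C lα
  n'≤n'*K = n≤n*K n' (Bounded-pos P b C bα)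
  sorted = OnOrd.merge-Sorted (D n b) (P ++ C) (D-Sorted n b sb) (OnOrd.Sorted-drop P b C sα)
  normal-exps = OnOrd.merge-All (D n b) (P ++ C) (All.map proj₁ (D-terms n b sb)) (OnOrd.All-drop P b C nα)
  counts : ∀ e → OnOrd.count e (merge leqE (D n b) (P ++ C)) ≤ n * K
  counts e rewrite OnOrd.count-merge e (D n b) (P ++ C) =
    subst (OnOrd.count e (D n b) + OnOrd.count e (P ++ C) ≤_) (+-comm (n' * K) K)
      (+-mono-≤ (≤-trans (D-count n b sb e) (*-monoʳ-≤ n' |b|≤K)) (≤-trans (OnOrd.count-drop e P b C) (cα e)))
  lengths : All (λ e → length e ≤ n * K) (merge leqE (D n b) (P ++ C))
  lengths = OnOrd.merge-All (D n b) (P ++ C)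
     (All.map (λ t → ≤-trans (proj₂ (proj₂ t))
                       (subst (n' + length b ≤_) (+-comm (n' * K) K) (+-mono-≤ n'≤n'*K |b|≤K)))
       (D-terms n b sb))
     (All.map (λ le → ≤-trans le (m≤m+n K (n' * K))) (OnOrd.All-drop P b C lα))

-- α' is a child of α for (z, n, K): reached from α below z, normal and (n·K)-bounded;
-- n ≤ z is recorded as well, as the main induction needs it.
Child : ℕ → ℕ → ℕ → Ord → Ord → Set
Child z n K α α' = Reach⁺ z α α' × Normal α' × Bounded (n * K) α' × n ≤ z

-- Since D_n(ω^b) lies below ω^b and above P, the member is P + (D_n(ω^b) ⊕ C),
-- reached from α by replace-term.
descent : ∀ {z n K} α → Normal α → Bounded K α → 1 ≤ n → n * K ≤ z → All (Child z n K α) (∂ n α)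
descent {z} {suc n'} {K} α nα bα _ nK≤z = AllP.map⁺ (All.map child (picks-split α))
  where
  n = suc n'
  child : ∀ {pr} → (Σ Ord λ P → Σ Ord λ C → (α ≡ P ++ proj₁ pr ∷ C) × (proj₂ pr ≡ P ++ C)) →
          Child z n K α (D n (proj₁ pr) ⊕ ⨁ (map (λ b → [ b ]) (proj₂ pr)))
  child {b , _} (P , C , refl , refl) =
    subst (Reach⁺ z α) (sym (trans as-merge as-replace)) reach ,
    subst Normal (sym as-merge) nα' ,
    subst (Bounded (n * K)) (sym as-merge) bα' ,
    ≤-trans (n≤n*K n (Bounded-pos P b C bα)) nK≤z
    where
    Dn = D n b
    nα' = proj₁ (∂-member-normal-bounded n' K P b C nα bα)
    bα' = proj₂ (∂-member-normal-bounded n' K P b C nα bα)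
    D<b : All (λ d → ¬ T (leqE b d)) Dn
    D<b = All.map (λ t → proj₁ (proj₂ t)) (D-terms n b (OnOrd.All-middle P b C (proj₂ nα)))
    as-merge : Dn ⊕ ⨁ (map (λ b → [ b ]) (P ++ C)) ≡ merge leqE Dn (P ++ C)
    as-merge = cong (merge leqE Dn) (OnOrd.merge-singletons (P ++ C) (OnOrd.Sorted-drop P b C (proj₁ nα)))
    as-replace : merge leqE Dn (P ++ C) ≡ P ++ merge leqE Dn C
    as-replace = OnOrd.merge-passes P Dn C
      (All.map (λ {a} b≤a → All.map (λ {d} b≰d a≤d → b≰d (leqE-trans b a d b≤a a≤d)) D<b)
        (OnOrd.Sorted-prefix-above P b C (proj₁ nα)))
    reach : Reach⁺ z (P ++ b ∷ C) (P ++ merge leqE Dn C)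
    reach = replace-term z C P b Dn (OnOrd.Sorted-suffix P (b ∷ C) (proj₁ nα)) D<b
              (subst Normal as-replace nα') (subst (Bounded z) as-replace (Bounded-mono nK≤z bα'))

M-from-members : ∀ g β n B → All (λ α' → Σ ℕ λ m → MR g α' (g n) m × m < B) (∂ n β) →
    Σ ℕ λ M → MR g β n M × M ≤ B
M-from-members g β n B members with collect (∂ n β) members
  where
  collect : ∀ L → All (λ α' → Σ ℕ λ m → MR g α' (g n) m × m < B) L →
            Σ (List ℕ) λ ms → Pointwise (λ α' m → MR g α' (g n) m) L ms × maxL (map suc ms) ≤ B
  collect [] [] = [] , [] , z≤n
  collect (a ∷ L) ((m , r , m<B) ∷ as) with collect L as
  ... | ms , pw , max≤B = m ∷ ms , r ∷ pw , ⊔-lub m<B max≤B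
... | ms , pw , max≤B = maxL (map suc ms) , mk ms pw , max≤B

Total : (ℕ → ℕ) → Ord → Set
Total h α = ∀ x → Σ ℕ (λ m → LH h α x m)

Total-snoc : ∀ h e R → Total h R → Total h (R ++ [ e ])
Total-snoc h = ExpInduction.exp-ind (λ e → ∀ R → Total h R → Total h (R ++ [ e ])) succ-case zero-case suc-case
  where
  succ-case : ∀ R → Total h R → Total h (R ++ [ [] ])
  succ-case R tR x with tR (h x)
  ... | m , d = suc m , ls (kind-succ R) d
  zero-case : ∀ d → (∀ R → Total h R → Total h (R ++ [ d ])) → ∀ R → Total h R → Total h (R ++ [ d ++ [ 0 ] ])
  zero-case d td R tR x with copies (suc x) x
    where
    copies : ∀ j → Total h (R ++ replicate j d)
    copies zero = subst (Total h) (sym (++-identityʳ R)) tR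
    copies (suc j) = subst (Total h) (++-replicate-snoc R j d) (td (R ++ replicate j d) (copies j))
  ... | m , lh = m , ll (kind-lim-zero R d) lh
  suc-case : ∀ d q → (∀ j → ∀ R → Total h R → Total h (R ++ [ d ++ replicate j q ])) →
             ∀ R → Total h R → Total h (R ++ [ d ++ [ suc q ] ])
  suc-case d q ih R tR x with ih (suc x) R tR x
  ... | m , lh = m , ll (kind-lim-suc R d q) lh

h-total : ∀ h α → Total h α
h-total h α = append α [] (λ x → 0 , lz refl)
  where
  append : ∀ α R → Total h R → Total h (R ++ α)
  append [] R tR = subst (Total h) (sym (++-identityʳ R)) tR
  append (e ∷ α) R tR = subst (Total h) (++-assoc R [ e ] α) (append α (R ++ [ e ]) (Total-snoc h e R tR))

module MainInduction (g : ℕ → ℕ) (smooth : Smooth g) where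

  h : ℕ → ℕ
  h x = x * g x

  g-monotone : ∀ {x y} → x ≤ y → g x ≤ g y
  g-monotone {x} x≤y = go (≤⇒≤′ x≤y)
    where
    go : ∀ {y} → x ≤′ y → g x ≤ g y
    go ≤′-refl = ≤-refl
    go (≤′-step {y'} p) = ≤-trans (go p) (≤-trans (n≤1+n (g y')) (proj₁ (smooth y')))

  g-pos : ∀ x → 1 ≤ g x
  g-pos x = ≤-pred (≤-trans (s≤s (s≤s z≤n)) (subst (_≤ suc (g x)) (+-comm x 2) (proj₂ (smooth x))))

  x≤h : ∀ x → x ≤ h x
  x≤h x = n≤n*K x (g-pos x)

  child-bound : ∀ {n K y} → n * K ≤ y → n ≤ y → g n * (n * K) ≤ h y
  child-bound {n} {K} {y} nK≤y n≤y =
    ≤-trans (*-monoʳ-≤ (g n) nK≤y) (subst (g n * y ≤_) (*-comm (g y) y) (*-monoˡ-≤ y (g-monotone n≤y)))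

  -- The induction is on the derivation of h_γ(y): a
  -- successor step is paid for by the descent lemma, a limit step by the Bachmann property.
  M-below : ∀ {γ y mγ β n K} → LH h γ y mγ → Reach y γ β → Normal β → Bounded K β → 1 ≤ n → n * K ≤ y →
            Σ ℕ λ M → MR g β n M × M ≤ mγ
  M-strictly-below : ∀ {γ y mγ β n K} → LH h γ y mγ → Reach⁺ y γ β → Normal β → Bounded K β →
            1 ≤ n → n * K ≤ h y →
            Σ ℕ λ M → MR g β n M × M < mγ

  M-below {β = β} {n} lh r nβ bβ n≥1 nK≤y = M-from-members g β n _
    (All.map (λ { (r⁺ , nα' , bα' , n≤y) →
                  M-strictly-below lh (Reach-Reach⁺-trans r r⁺) nα' bα' (g-pos n) (child-bound nK≤y n≤y) })
      (descent β nβ bβ n≥1 nK≤y))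

  M-strictly-below (lz kz) (psucc ks _) _ _ _ _ = ⊥-elim (zeroK≢succK (trans (sym kz) ks))
  M-strictly-below (lz kz) (plim kl _ _) _ _ _ _ = ⊥-elim (zeroK≢limK (trans (sym kz) kl))
  M-strictly-below (ls ks _) (plim kl _ _) _ _ _ _ = ⊥-elim (succK≢limK (trans (sym ks) kl))
  M-strictly-below (ll kl _) (psucc ks _) _ _ _ _ = ⊥-elim (succK≢limK (trans (sym ks) kl))
  M-strictly-below {y = y} (ls ks lh) (psucc ks' r) nβ bβ n≥1 nK≤hy with succK-injective (trans (sym ks) ks')
  ... | refl with M-below lh (Reach-mono (x≤h y) r) nβ bβ n≥1 nK≤hy
  ...   | M , mr , M≤ = M , mr , s≤s M≤
  M-strictly-below {γ} (ll {f = f} kl lh) (plim kl' c≤y r⁺) nβ bβ n≥1 nK≤hy with limK-injective (trans (sym kl) kl')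
  ... | refl = M-strictly-below lh (Reach-Reach⁺-trans (bachmann γ f kl c≤y) r⁺) nβ bβ n≥1 nK≤hy

size : Ord → ℕ
size α = length α + foldr (λ e s → length e + s) 0 α

Bounded-size : ∀ α → Bounded (size α) α
Bounded-size α = (λ e → ≤-trans (OnOrd.count≤length e α) (m≤m+n (length α) _)) ,
                 All.map (λ le → ≤-trans le (m≤n+m _ (length α))) (lengths≤ α)
  where
  lengths≤ : ∀ α → All (λ e → length e ≤ foldr (λ e s → length e + s) 0 α) α
  lengths≤ [] = []
  lengths≤ (e ∷ α) = m≤m+n (length e) _ ∷ All.map (λ le → ≤-trans le (m≤n+m _ (length e))) (lengths≤ α)

proposition6 : (g : ℕ → ℕ) → Smooth g → (α : Ord) → CNF α →
    Σ ℕ (λ k → (n : ℕ) → 0 < n →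
      Σ ℕ (λ m → Σ ℕ (λ m' →
        MR g α n m × LH (λ x → x * g x) α (k * n) m' × m ≤ m')))
proposition6 g smooth α (exps-cnf , desc) = size α , bound
  where
  open MainInduction g smooth
  normal : Normal α
  normal = OnOrd.Desc⇒Sorted α desc , All.map (λ {e} → OnExp.Desc⇒Sorted e) exps-cnf
  bound : (n : ℕ) → 0 < n → Σ ℕ (λ m → Σ ℕ (λ m' → MR g α n m × LH h α (size α * n) m' × m ≤ m'))
  bound n n>0 with h-total h α (size α * n)
  ... | m' , lh with M-below lh rrefl normal (Bounded-size α) n>0 (≤-reflexive (*-comm n (size α)))
  ...   | m , mr , m≤m' = m , m' , mr , lh , m≤m'
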